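{- Let $G$ be a graph and let $x,u,y,v$ be four different vertices of $G$. Let $P_a$ be a geodesic from $x$ to $u$, $P_b$ a geodesic from $x$ to $v$, $P_c$ a geodesic from $y$ to $u$, and $P_d$ a geodesic from $y$ to $v$ (each viewed as a set of vertices). If $2\delta_G(x,y,u,v)=(xy+uv)-\max(xu+yv,xv+yu)$, then $\delta_G(x,y,u,v)\le\min(d(P_a,P_d),d(P_b,P_c))$.
   Context: Graphs are simple, unweighted, connected, possibly infinite, with shortest-path metric $d=d_G$, and $pq$ abbreviates $d_G(p,q)$. For vertex sets $S,T$, $d(S,T)=\min_{s\in S,t\in T}d(s,t)$. A geodesic between two vertices is a shortest path between them. $\delta_G(x,y,u,v)$ is the difference between the largest and second largest of $\frac{uv+xy}{2},\frac{ux+vy}{2},\frac{uy+vx}{2}$. -}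

module Defs where

open import Data.Nat using (ℕ; zero; suc; _+_; _∸_; _⊓_; _⊔_; _≤_)
open import Data.List.NonEmpty using (List⁺; _∷_; [_]; _∷⁺_; foldr₁; concatMap; map)
open import Relation.Binary.PropositionalEquality using (_≡_)
open import Relation.Nullary using (¬_)

record Graph : Set₁ where
  field
    V     : Set
    Adj   : V → V → Set
    sym   : ∀ {p q} → Adj p q → Adj q p
    irref : ∀ {p} → ¬ Adj p p

module _ (G : Graph) where
  open Graph G

  data Walk : V → V → ℕ → Set where
    nil  : ∀ {p} → Walk p p 0
    cons : ∀ {p q r n} → Adj p q → Walk q r n → Walk p r (suc n)

  verts : ∀ {p q n} → Walk p q n → List⁺ V
  verts {p} nil        = [ p ]
  verts {p} (cons _ w) = p ∷⁺ verts w

  -- d is the shortest-path metric of G: for all p q there is a walk of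
  -- length d p q, and every walk from p to q has length ≥ d p q.
  -- (The existence of the walks also expresses that G is connected.)
  record IsShortestPathMetric (d : V → V → ℕ) : Set where
    field
      realised : ∀ p q → Walk p q (d p q)
      minimal  : ∀ {p q n} → Walk p q n → d p q ≤ n

  Geodesic : (d : V → V → ℕ) → V → V → Set
  Geodesic d p q = Walk p q (d p q)

setDist : {V : Set} → (V → V → ℕ) → List⁺ V → List⁺ V → ℕ
setDist d S T = foldr₁ _⊓_ (concatMap (λ s → map (d s) T) S)

median3 : ℕ → ℕ → ℕ → ℕ
median3 a b c = ((a ⊓ b) ⊔ (b ⊓ c)) ⊔ (a ⊓ c)

-- 2·δ(x,y,u,v): twice the difference between the largest and second largest
-- of (uv+xy)/2, (ux+vy)/2, (uy+vx)/2, i.e. (largest − second largest) of the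
-- doubled sums; always a natural number.
twoδ : {V : Set} → (V → V → ℕ) → V → V → V → V → ℕ
twoδ d x y u v =
  let a = d u v + d x y
      b = d u x + d v y
      c = d u y + d v x
  in ((a ⊔ b) ⊔ c) ∸ median3 a b c

-- For p on Pa and q on Pd, the triangle inequality along x→p→q→y and
-- u→p→q→v gives xy + uv ≤ xu + yv + 2·pq, while the hypothesis says
-- xy + uv = max(xu + yv, xv + yu) + 2δ; hence 2δ ≤ 2·pq.  Choosing p, q that
-- realise d(Pa, Pd) gives one bound, and Pb, Pc symmetrically the other.
module Submission where

open import Defs
open import Data.Nat using (ℕ; suc; _+_; _*_; _⊓_; _⊔_; _≤_; s≤s)
open import Data.Nat.Properties
open import Data.Nat.Solver using (module +-*-Solver)
open import Data.Integer using (+_; _-_)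
import Data.Integer as ℤ
import Data.Integer.Properties as ℤ
open import Data.Product using (∃₂; _×_; _,_)
open import Data.Sum using (inj₁; inj₂)
open import Data.List using ([]; _∷_)
import Data.List as List
open import Data.List.NonEmpty using (List⁺; _∷_; toList; foldr₁)
import Data.List.NonEmpty as List⁺
open import Data.List.NonEmpty.Properties using (toList->>=)
open import Data.List.Relation.Unary.All using (All; []; _∷_)
import Data.List.Relation.Unary.All as All
open import Data.List.Relation.Unary.Any using (here; there)
open import Data.List.Membership.Propositional using (_∈_; find)
open import Data.List.Membership.Propositional.Properties using (∈-concatMap⁻; ∈-map⁻)
open import Relation.Binary.PropositionalEquality

foldr₁-⊓-∈ : (ns : List⁺ ℕ) → foldr₁ _⊓_ ns ∈ toList ns
foldr₁-⊓-∈ (n ∷ ns) = go n ns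
  where
  go : ∀ n ns → foldr₁ _⊓_ (n ∷ ns) ∈ n ∷ ns
  go n []       = here refl
  go n (m ∷ ms) with ⊓-sel n (foldr₁ _⊓_ (m ∷ ms))
  ... | inj₁ n⊓≡n    = here n⊓≡n
  ... | inj₂ n⊓≡rest = there (subst (_∈ _) (sym n⊓≡rest) (go m ms))

setDist-∈-distances : ∀ {V : Set} (d : V → V → ℕ) (S T : List⁺ V) →
                      setDist d S T ∈ List.concatMap (λ s → List.map (d s) (toList T)) (toList S)
setDist-∈-distances d S T =
  subst (setDist d S T ∈_) (sym (toList->>= (λ s → List⁺.map (d s) T) S))
        (foldr₁-⊓-∈ (List⁺.concatMap (λ s → List⁺.map (d s) T) S))

setDist-attained : ∀ {V : Set} (d : V → V → ℕ) (S T : List⁺ V) →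
                   ∃₂ λ s t → s ∈ toList S × t ∈ toList T × setDist d S T ≡ d s t
setDist-attained d S T
  with find (∈-concatMap⁻ (λ s → List.map (d s) (toList T)) {xs = toList S} (setDist-∈-distances d S T))
... | s , s∈S , m∈dsT with ∈-map⁻ (d s) m∈dsT
... | t , t∈T , m≡dst = s , t , s∈S , t∈T , m≡dst

module _ (G : Graph) where
  open Graph G using (V; Adj) renaming (sym to Adj-sym)

  append : ∀ {p q r m n} → Walk G p q m → Walk G q r n → Walk G p r (m + n)
  append nil        w′ = w′
  append (cons e w) w′ = cons e (append w w′)

  snoc : ∀ {p q r n} → Walk G p q n → Adj q r → Walk G p r (suc n)
  snoc nil         e = cons e nil
  snoc (cons e′ w) e = cons e′ (snoc w e)

  reverse : ∀ {p q n} → Walk G p q n → Walk G q p n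
  reverse nil        = nil
  reverse (cons e w) = snoc (reverse w) (Adj-sym e)

  module ShortestPathMetric {d : V → V → ℕ} (sp : IsShortestPathMetric G d) where
    open IsShortestPathMetric sp

    d-refl : ∀ p → d p p ≡ 0
    d-refl p = n≤0⇒n≡0 (minimal {p} nil)

    d-sym : ∀ p q → d p q ≡ d q p
    d-sym p q = ≤-antisym (minimal (reverse (realised q p))) (minimal (reverse (realised p q)))

    d-triangle : ∀ p q r → d p r ≤ d p q + d q r
    d-triangle p q r = minimal (append (realised p q) (realised q r))

    d-triangle₃ : ∀ p q r s → d p s ≤ d p q + d q r + d r s
    d-triangle₃ p q r s = begin
      d p s                 ≤⟨ d-triangle p r s ⟩
      d p r + d r s         ≤⟨ +-monoˡ-≤ (d r s) (d-triangle p q r) ⟩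
      d p q + d q r + d r s ∎
      where open ≤-Reasoning

    walk-verts-detour : ∀ {p q n} (w : Walk G p q n) → All (λ s → d p s + d s q ≤ n) (toList (verts G w))
    walk-verts-detour {p} nil = ≤-reflexive (cong₂ _+_ (d-refl p) (d-refl p)) ∷ []
    walk-verts-detour {p} {q} {suc n} (cons {q = r} e w) =
      head-detour ∷ All.map tail-detour (walk-verts-detour w)
      where
      head-detour : d p p + d p q ≤ suc n
      head-detour = ≤-trans (≤-reflexive (cong (_+ d p q) (d-refl p))) (minimal (cons e w))
      tail-detour : ∀ {s} → d r s + d s q ≤ n → d p s + d s q ≤ suc n
      tail-detour {s} detour = ≤-trans (+-monoˡ-≤ (d s q) (minimal (cons e (realised r s)))) (s≤s detour)

    detour-sum-bound : ∀ {x y u v p q} → d x p + d p u ≤ d x u → d y q + d q v ≤ d y v →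
                       d x y + d u v ≤ d x u + d y v + 2 * d p q
    detour-sum-bound {x} {y} {u} {v} {p} {q} p-between q-between = begin
      d x y + d u v
        ≤⟨ +-mono-≤ (d-triangle₃ x p q y) (d-triangle₃ u p q v) ⟩
      (d x p + d p q + d q y) + (d u p + d p q + d q v)
        ≡⟨ cong₂ (λ qy up → (d x p + d p q + qy) + (up + d p q + d q v)) (d-sym q y) (d-sym u p) ⟩
      (d x p + d p q + d y q) + (d p u + d p q + d q v)
        ≡⟨ regroup (d x p) (d p q) (d y q) (d p u) (d q v) ⟩
      (d x p + d p u) + (d y q + d q v) + 2 * d p q
        ≤⟨ +-monoˡ-≤ (2 * d p q) (+-mono-≤ p-between q-between) ⟩
      d x u + d y v + 2 * d p q ∎
      where
      open ≤-Reasoning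
      open +-*-Solver
      regroup : ∀ a b c e f → (a + b + c) + (e + b + f) ≡ (a + e) + (c + f) + 2 * b
      regroup = solve 5 (λ a b c e f → (a :+ b :+ c) :+ (e :+ b :+ f) := (a :+ e) :+ (c :+ f) :+ con 2 :* b) refl

    excess≤2*setDist : ∀ {t x y u v} → t + (d x u + d y v) ≤ d x y + d u v →
                       (P : Geodesic G d x u) (Q : Geodesic G d y v) →
                       t ≤ 2 * setDist d (verts G P) (verts G Q)
    excess≤2*setDist {t} {x} {y} {u} {v} excess P Q =
      let p , q , p∈P , q∈Q , setDist≡dpq = setDist-attained d (verts G P) (verts G Q)
      in  ≤-trans (t≤2*d p q p∈P q∈Q) (≤-reflexive (cong (2 *_) (sym setDist≡dpq)))
      where
      open ≤-Reasoning
      t≤2*d : ∀ p q → p ∈ toList (verts G P) → q ∈ toList (verts G Q) → t ≤ 2 * d p q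
      t≤2*d p q p∈P q∈Q = +-cancelˡ-≤ (d x u + d y v) t (2 * d p q) (begin
        d x u + d y v + t         ≡⟨ +-comm (d x u + d y v) t ⟩
        t + (d x u + d y v)       ≤⟨ excess ⟩
        d x y + d u v             ≤⟨ detour-sum-bound (All.lookup (walk-verts-detour P) p∈P)
                                                      (All.lookup (walk-verts-detour Q) q∈Q) ⟩
        d x u + d y v + 2 * d p q ∎)

+m≡+n-+o⇒m+o≡n : ∀ {m n o} → + m ≡ + n - + o → m + o ≡ n
+m≡+n-+o⇒m+o≡n {m} {n} {o} +m≡ = ℤ.+-injective (begin
  + (m + o)                  ≡⟨ ℤ.pos-+ m o ⟩
  + m ℤ.+ + o                ≡⟨ cong (ℤ._+ + o) +m≡ ⟩
  + n - + o ℤ.+ + o          ≡⟨ ℤ.+-assoc (+ n) (ℤ.- + o) (+ o) ⟩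
  + n ℤ.+ (ℤ.- + o ℤ.+ + o)  ≡⟨ cong (ℤ._+_ (+ n)) (ℤ.+-inverseˡ (+ o)) ⟩
  + n ℤ.+ + 0                ≡⟨ ℤ.+-identityʳ (+ n) ⟩
  + n                        ∎)
  where open ≡-Reasoning

lemma4p12 : (G : Graph) (d : Graph.V G → Graph.V G → ℕ) → IsShortestPathMetric G d →
    (x u y v : Graph.V G) →
    x ≢ u → x ≢ y → x ≢ v → u ≢ y → u ≢ v → y ≢ v →
    (Pa : Geodesic G d x u) (Pb : Geodesic G d x v) (Pc : Geodesic G d y u) (Pd : Geodesic G d y v) →
    + twoδ d x y u v ≡ (+ (d x y + d u v)) - (+ ((d x u + d y v) ⊔ (d x v + d y u))) →
    twoδ d x y u v ≤ 2 * (setDist d (verts G Pa) (verts G Pd) ⊓ setDist d (verts G Pb) (verts G Pc))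
lemma4p12 G d sp x u y v _ _ _ _ _ _ Pa Pb Pc Pd twoδ≡ = begin
  t                      ≤⟨ ⊓-glb (excess≤2*setDist excess-ad Pa Pd) (excess≤2*setDist excess-bc Pb Pc) ⟩
  (2 * dad) ⊓ (2 * dbc)  ≡⟨ *-distribˡ-⊓ 2 dad dbc ⟨
  2 * (dad ⊓ dbc)        ∎
  where
  open ≤-Reasoning
  open ShortestPathMetric G sp
  t dad dbc : ℕ
  t = twoδ d x y u v
  dad = setDist d (verts G Pa) (verts G Pd)
  dbc = setDist d (verts G Pb) (verts G Pc)
  t+max≡ : t + ((d x u + d y v) ⊔ (d x v + d y u)) ≡ d x y + d u v
  t+max≡ = +m≡+n-+o⇒m+o≡n twoδ≡
  excess-ad : t + (d x u + d y v) ≤ d x y + d u v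
  excess-ad = ≤-trans (+-monoʳ-≤ t (m≤m⊔n _ _)) (≤-reflexive t+max≡)
  excess-bc : t + (d x v + d y u) ≤ d x y + d v u
  excess-bc = ≤-trans (+-monoʳ-≤ t (m≤n⊔m _ _)) (≤-reflexive (trans t+max≡ (cong (_+_ (d x y)) (d-sym u v))))
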